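{- Let $t\geq 2$ be an integer. Then the largest size of a $(t,t+1)$-core partition with distinct parts is $\lfloor t(t+1)/6\rfloor$. The number of $(t,t+1)$-core partitions with distinct parts having this largest size is $2$ if $t\equiv 1 \pmod 3$ and $1$ otherwise.
   Context: A partition is a finite weakly decreasing sequence $\lambda=(\lambda_1,\ldots,\lambda_\ell)$ of positive integers; its size is $\sum_i\lambda_i$, and it has distinct parts if $\lambda_1>\lambda_2>\cdots>\lambda_\ell$. In the Young diagram of $\lambda$, the hook length of box $(i,j)$ is the number of boxes directly to its right, directly below it, plus the box itself. For a positive integer $s$, $\lambda$ is an $s$-core partition if no hook length is divisible by $s$; it is a $(t_1,t_2)$-core partition if it is both a $t_1$-core and a $t_2$-core. $\lfloor x\rfloor$ denotes the largest integer not exceeding $x$. -}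

module Defs where

open import Data.Nat using (ℕ; zero; suc; _+_; _∸_; _<_; _≤_; _>_; _≥_; _<ᵇ_)
open import Data.Nat.Divisibility using (_∣_)
open import Data.List using (List; []; _∷_)
open import Data.Nat.ListAction using (sum)
open import Data.List.Relation.Unary.All using (All)
open import Data.List.Relation.Unary.Linked using (Linked)
open import Data.Bool using (if_then_else_)
open import Data.Product using (_×_)
open import Relation.Nullary using (¬_)

IsPartition : List ℕ → Set
IsPartition λs = All (λ x → 1 ≤ x) λs × Linked _≥_ λs

DistinctParts : List ℕ → Set
DistinctParts λs = Linked _>_ λs

size : List ℕ → ℕ
size = sum

-- i-th part (0-indexed), 0 if out of range
part : List ℕ → ℕ → ℕ
part [] _ = 0
part (x ∷ _) zero = x
part (_ ∷ xs) (suc i) = part xs i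

-- length of column j (0-indexed): number of parts > j
colLen : List ℕ → ℕ → ℕ
colLen [] _ = 0
colLen (x ∷ xs) j = (if j <ᵇ x then 1 else 0) + colLen xs j

-- hook length of box (i , j) (0-indexed row i, column j, with j < part λ i):
-- boxes to the right + boxes below + 1
hook : List ℕ → ℕ → ℕ → ℕ
hook λs i j = (part λs i ∸ suc j) + (colLen λs j ∸ suc i) + 1

IsCore : ℕ → List ℕ → Set
IsCore s λs = ∀ i j → j < part λs i → ¬ (s ∣ hook λs i j)

DistinctCore : ℕ → List ℕ → Set
DistinctCore t λs = IsPartition λs × DistinctParts λs × IsCore t λs × IsCore (suc t) λs

module Submission where

-- Let μ have distinct parts, first part a and ℓ parts.
-- (1) Hooks: all hooks are < a + ℓ, and for distinct parts the first-row hooks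
--     descend from a + ℓ − 1 to 1 in steps of at most 2.  So for t ≥ 2, μ is a
--     (t, t+1)-core iff a + ℓ ≤ t (else a first-row hook equals t or t + 1).
-- (2) Dominance: such μ lies below the staircase (c + ℓ, …, c + 1), c = a − ℓ,
--     which satisfies c + 2ℓ ≤ t, with equal size only if μ is the staircase.
-- (3) Arithmetic: for a staircase with s = c + 2ℓ and t = s + e,
--       t(t+1) = 6 · size + d(d+1) + e(2s + e + 1),   d measuring |c − ℓ|,
--     so size ≤ ⌊t(t+1)/6⌋, with equality iff e = 0 and c − ℓ ∈ {0, 1, −1, −2}
--     (the "balanced" shapes).
-- (4) Counting: the balanced shapes with c + 2ℓ = t are fixed by t mod 3, one
--     for t ≢ 1 and two for t ≡ 1.  The theorem combines size-bound (1–3) with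
--     the enumeration balanced-stairs (4).

open import Defs
open import Data.Nat using (ℕ; zero; suc; _+_; _*_; _∸_; _≤_; _<_; _>_; _≥_; _/_; _%_; _≡ᵇ_; _<ᵇ_; _≤?_; z≤n; s≤s; NonZero; >-nonZero)
open import Data.Nat.Properties
open import Data.Nat.DivMod using (m*n/n≡m; /-monoˡ-≤; m<n*o⇒m/o<n; m≡m%n+[m/n]*n; m%n<n; [m+kn]%n≡m%n; m<n⇒m%n≡m)
open import Data.Nat.Divisibility using (_∣_; ∣-refl; >⇒∤)
open import Data.Nat.Tactic.RingSolver using (solve)
open import Data.List as List using (List; []; _∷_; length)
open import Data.List.Relation.Unary.All as All using (All; []; _∷_)
open import Data.List.Relation.Unary.Linked as Linked using (Linked; []; [-]; _∷_)
open import Data.List.Relation.Unary.Linked.Properties using (Linked⇒All)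
open import Data.List.Relation.Unary.AllPairs using ([]; _∷_)
open import Data.List.Relation.Unary.Unique.Propositional using (Unique)
open import Data.List.Membership.Propositional using (_∈_)
open import Data.List.Relation.Unary.Any using (here; there)
open import Data.Bool using (true; false; if_then_else_)
open import Data.Product using (Σ; _×_; _,_; proj₁; proj₂)
open import Data.Sum using (_⊎_; inj₁; inj₂; [_,_])
open import Data.Empty using (⊥-elim)
open import Function.Bundles using (_⇔_; mk⇔)
open import Function.Properties.Equivalence using () renaming (trans to ⇔-trans)
open import Relation.Nullary using (yes; no; contradiction)
open import Relation.Binary.Definitions using (tri<; tri≈; tri>)
open import Relation.Binary.PropositionalEquality using (_≡_; refl; sym; trans; cong; cong₂; subst; module ≡-Reasoning)

firstPart : List ℕ → ℕ
firstPart []      = 0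
firstPart (x ∷ _) = x

stair : ℕ → ℕ → List ℕ
stair c zero    = []
stair c (suc ℓ) = c + suc ℓ ∷ stair c ℓ

stair-length : ∀ c ℓ → length (stair c ℓ) ≡ ℓ
stair-length c zero    = refl
stair-length c (suc ℓ) = cong suc (stair-length c ℓ)

stair-length-injective : ∀ {c c′ ℓ ℓ′} → stair c ℓ ≡ stair c′ ℓ′ → ℓ ≡ ℓ′
stair-length-injective {c} {c′} {ℓ} {ℓ′} eq =
  trans (sym (stair-length c ℓ)) (trans (cong length eq) (stair-length c′ ℓ′))

stair-first : ∀ c ℓ → firstPart (stair c ℓ) ≤ c + ℓ
stair-first c zero    = z≤n
stair-first c (suc ℓ) = ≤-refl

stair-distinct : ∀ c ℓ → DistinctParts (stair c ℓ)
stair-distinct c zero          = []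
stair-distinct c (suc zero)    = [-]
stair-distinct c (suc (suc ℓ)) = +-monoʳ-< c (n<1+n (suc ℓ)) ∷ stair-distinct c (suc ℓ)

stair-partition : ∀ c ℓ → IsPartition (stair c ℓ)
stair-partition c ℓ = positive ℓ , Linked.map <⇒≤ (stair-distinct c ℓ)
  where
  positive : ∀ ℓ → All (1 ≤_) (stair c ℓ)
  positive zero    = []
  positive (suc ℓ) = ≤-trans (s≤s z≤n) (m≤n+m (suc ℓ) c) ∷ positive ℓ

double-stair-size : ∀ c ℓ → 2 * size (stair c ℓ) ≡ 2 * c * ℓ + ℓ * suc ℓ
double-stair-size c zero    = sym (cong (_+ 0) (*-zeroʳ (2 * c)))
double-stair-size c (suc ℓ) = begin
  2 * (c + suc ℓ + size (stair c ℓ))          ≡⟨ *-distribˡ-+ 2 (c + suc ℓ) _ ⟩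
  2 * (c + suc ℓ) + 2 * size (stair c ℓ)      ≡⟨ cong (2 * (c + suc ℓ) +_) (double-stair-size c ℓ) ⟩
  2 * (c + suc ℓ) + (2 * c * ℓ + ℓ * suc ℓ)   ≡⟨ solve (c List.∷ ℓ List.∷ List.[]) ⟩
  2 * c * suc ℓ + suc ℓ * suc (suc ℓ)         ∎
  where open ≡-Reasoning

indicator-< : ∀ {j x} → j < x → (if j <ᵇ x then 1 else 0) ≡ 1
indicator-< {zero}  {suc x} _         = refl
indicator-< {suc j} {suc x} (s≤s j<x) = indicator-< j<x

indicator-≥ : ∀ {j x} → x ≤ j → (if j <ᵇ x then 1 else 0) ≡ 0
indicator-≥ {j}     {zero}  _         = refl
indicator-≥ {suc j} {suc x} (s≤s x≤j) = indicator-≥ x≤j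

indicator-≤1 : ∀ j x → (if j <ᵇ x then 1 else 0) ≤ 1
indicator-≤1 j x with j <ᵇ x
... | true  = ≤-refl
... | false = z≤n

colLen≤length : ∀ μ j → colLen μ j ≤ length μ
colLen≤length []      j = z≤n
colLen≤length (x ∷ μ) j = +-mono-≤ (indicator-≤1 j x) (colLen≤length μ j)

colLen-first : ∀ {μ} → All (1 ≤_) μ → colLen μ 0 ≡ length μ
colLen-first []          = refl
colLen-first (x≥1 ∷ pos) = cong₂ _+_ (indicator-< x≥1) (colLen-first pos)

colLen-empty : ∀ {μ j} → All (_≤ j) μ → colLen μ j ≡ 0
colLen-empty []           = refl
colLen-empty (x≤j ∷ rest) = cong₂ _+_ (indicator-≥ x≤j) (colLen-empty rest)

below-first : ∀ {x μ} → Linked _>_ (x ∷ μ) → All (_< x) μ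
below-first {μ = []}    _      = []
below-first {μ = _ ∷ _} sorted =
  Linked⇒All (λ y>z z>w → <-trans z>w y>z) (Linked.head sorted) (Linked.tail sorted)

-- With distinct parts at most one part equals j + 1, so column j is at most
-- one box longer than column j + 1.
colLen-step : ∀ {μ} j → Linked _>_ μ → colLen μ j ≤ suc (colLen μ (suc j))
colLen-step {[]}    j _ = z≤n
colLen-step {x ∷ μ} j sorted with <-cmp (suc j) x
... | tri< j+1<x _ _
  rewrite indicator-< (<-trans (n<1+n j) j+1<x) | indicator-< j+1<x =
  s≤s (colLen-step j (Linked.tail sorted))
... | tri≈ _ refl _
  rewrite indicator-< (n<1+n j) | indicator-≥ (≤-refl {suc j})
        | colLen-empty (All.map ≤-pred (below-first sorted)) = s≤s z≤n
... | tri> _ _ x<j+1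
  rewrite indicator-≥ (≤-pred x<j+1) | indicator-≥ (<⇒≤ x<j+1) =
  colLen-step j (Linked.tail sorted)

part≤first : ∀ {μ} i → Linked _≥_ μ → part μ i ≤ firstPart μ
part≤first {[]}        i       _            = z≤n
part≤first {x ∷ μ}     zero    _            = ≤-refl
part≤first {x ∷ []}    (suc i) _            = z≤n
part≤first {x ∷ y ∷ μ} (suc i) (x≥y ∷ rest) = ≤-trans (part≤first i rest) x≥y

hook<first+length : ∀ {μ} i j → Linked _≥_ μ → j < part μ i → hook μ i j < firstPart μ + length μ
hook<first+length {[]}    i j _      ()
hook<first+length {x ∷ ν} i j sorted j<p = begin-strict
  arm + leg + 1        ≡⟨ +-comm (arm + leg) 1 ⟩
  suc arm + leg        ≤⟨ +-mono-≤ (≤-trans (arm<part j<p) (part≤first i sorted)) leg≤ ⟩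
  x + length ν         <⟨ +-monoʳ-< x (n<1+n (length ν)) ⟩
  x + suc (length ν)   ∎
  where
  open ≤-Reasoning
  arm leg : ℕ
  arm = part (x ∷ ν) i ∸ suc j
  leg = colLen (x ∷ ν) j ∸ suc i
  arm<part : ∀ {p} → j < p → suc (p ∸ suc j) ≤ p
  arm<part {suc p} _ = s≤s (m∸n≤m p j)
  leg≤ : leg ≤ length ν
  leg≤ = ≤-trans (∸-monoˡ-≤ (suc i) (colLen≤length (x ∷ ν) j)) (m∸n≤m (length ν) i)

-- If the first part plus the length is at most s, then μ is an s-core: every
-- hook is positive and smaller than s.
core-of-small : ∀ {μ s} → Linked _≥_ μ → firstPart μ + length μ ≤ s → IsCore s μ
core-of-small sorted small i j j<p =
  >⇒∤ {{>-nonZero (m≤n+m 1 _)}} (≤-trans (hook<first+length i j sorted j<p) small)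

distinct-core-of-small : ∀ {t μ} → IsPartition μ → DistinctParts μ →
                         firstPart μ + length μ ≤ t → DistinctCore t μ
distinct-core-of-small p@(_ , sorted) distinct small =
  p , distinct , core-of-small sorted small , core-of-small sorted (m≤n⇒m≤1+n small)

crossing : ∀ (g : ℕ → ℕ) {t} k → t ≤ g 0 → g k < t → (∀ j → j < k → g j ≤ 2 + g (suc j)) →
           Σ ℕ λ j → j ≤ k × t ≤ g j × g j ≤ suc t
crossing g zero        start end _     = contradiction start (<⇒≱ end)
crossing g {t} (suc k) start end steps with t ≤? g k
... | yes t≤gk = k , n≤1+n k , t≤gk , ≤-trans (steps k (n<1+n k)) (s≤s end)
... | no  t≰gk with crossing g k start (≰⇒> t≰gk) (λ j j<k → steps j (m<n⇒m<1+n j<k))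
...   | j , j≤k , hit = j , m≤n⇒m≤1+n j≤k , hit

between-divisible : ∀ {t h} → t ≤ h → h ≤ suc t → t ∣ h ⊎ suc t ∣ h
between-divisible t≤h h≤t+1 with m≤n⇒m<n∨m≡n t≤h
... | inj₁ t<h  = inj₂ (subst (_ ∣_) (≤-antisym t<h h≤t+1) ∣-refl)
... | inj₂ refl = inj₁ ∣-refl

first-row-start : ∀ {k ν} → All (1 ≤_) ν → hook (suc k ∷ ν) 0 0 ≡ k + length ν + 1
first-row-start {k} pos = cong (λ n → k + n + 1) (colLen-first pos)

first-row-end : ∀ {k ν} → Linked _>_ (suc k ∷ ν) → hook (suc k ∷ ν) 0 k ≡ 1
first-row-end {k} {ν} sorted = cong₂ (λ a b → a + (b ∸ 1) + 1) (n∸n≡0 k) last-column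
  where
  last-column : colLen (suc k ∷ ν) k ≡ 1
  last-column = cong₂ _+_ (indicator-< (n<1+n k)) (colLen-empty (All.map ≤-pred (below-first sorted)))

first-row-step : ∀ {k ν} j → Linked _>_ (suc k ∷ ν) → j < k →
                 hook (suc k ∷ ν) 0 j ≤ 2 + hook (suc k ∷ ν) 0 (suc j)
first-row-step {k} {ν} j sorted j<k = begin
  (k ∸ j) + (X ∸ 1) + 1       ≡⟨ cong (λ a → a + (X ∸ 1) + 1) (gap-suc j<k) ⟩
  suc A + (X ∸ 1) + 1         ≤⟨ +-monoˡ-≤ 1 (+-monoʳ-≤ (suc A) X∸1≤) ⟩
  suc A + suc (Y ∸ 1) + 1     ≡⟨ cong (λ a → suc a + 1) (+-suc A (Y ∸ 1)) ⟩
  2 + (A + (Y ∸ 1) + 1)       ∎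
  where
  open ≤-Reasoning
  A X Y : ℕ
  A = k ∸ suc j
  X = colLen (suc k ∷ ν) j
  Y = colLen (suc k ∷ ν) (suc j)
  gap-suc : ∀ {j k} → j < k → k ∸ j ≡ suc (k ∸ suc j)
  gap-suc {j} {suc k} (s≤s j≤k) = +-∸-assoc 1 j≤k
  X∸1≤ : X ∸ 1 ≤ suc (Y ∸ 1)
  X∸1≤ = ≤-trans (∸-monoˡ-≤ 1 (colLen-step j sorted)) (m≤n+m∸n Y 1)

-- For t ≥ 2 a (t, t+1)-core with distinct positive parts has a + ℓ ≤ t: otherwise
-- its first-row hooks descend from a + ℓ − 1 ≥ t to 1 < t and hit t or t + 1.
small-of-core : ∀ {t μ} → 2 ≤ t → All (1 ≤_) μ → Linked _>_ μ → IsCore t μ → IsCore (suc t) μ →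
                firstPart μ + length μ ≤ t
small-of-core {μ = []}        _ _         _ _ _ = z≤n
small-of-core {μ = zero ∷ _}  _ (() ∷ _)  _ _ _
small-of-core {t} {suc k ∷ ν} 2≤t (_ ∷ pos) sorted core core′ with suc k + length (suc k ∷ ν) ≤? t
... | yes small = small
... | no  large with crossing (hook (suc k ∷ ν) 0) k start end (λ j j<k → first-row-step j sorted j<k)
  where
  start : t ≤ hook (suc k ∷ ν) 0 0
  start = begin
    t                   ≤⟨ ≤-pred (≰⇒> large) ⟩
    k + suc (length ν)  ≡⟨ +-suc k (length ν) ⟩
    suc (k + length ν)  ≡⟨ +-comm 1 (k + length ν) ⟩
    k + length ν + 1    ≡⟨ first-row-start pos ⟨
    hook (suc k ∷ ν) 0 0 ∎
    where open ≤-Reasoning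
  end : hook (suc k ∷ ν) 0 k < t
  end = subst (_< t) (sym (first-row-end sorted)) 2≤t
...   | j , j≤k , t≤h , h≤t+1 =
  ⊥-elim ([ core 0 j (s≤s j≤k) , core′ 0 j (s≤s j≤k) ] (between-divisible t≤h h≤t+1))

≤-+-rigid : ∀ {a b c d} → a ≤ b → c ≤ d → a + c ≡ b + d → a ≡ b × c ≡ d
≤-+-rigid {a} {b} {c} {d} a≤b c≤d eq with m≤n⇒m<n∨m≡n a≤b
... | inj₂ refl = refl , +-cancelˡ-≡ a c d eq
... | inj₁ a<b  = contradiction eq (<⇒≢ (+-mono-<-≤ a<b c≤d))

tail-below : ∀ {c x ν} → Linked _>_ (x ∷ ν) → x ≤ c + suc (length ν) → firstPart ν ≤ c + length ν
tail-below {ν = []}         _             _  = z≤n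
tail-below {c} {ν = _ ∷ ν} (x>y ∷ _) x≤ =
  ≤-pred (≤-trans x>y (≤-trans x≤ (≤-reflexive (+-suc c (suc (length ν))))))

dominated : ∀ c {μ} → Linked _>_ μ → firstPart μ ≤ c + length μ → size μ ≤ size (stair c (length μ))
dominated c {[]}    _      _  = z≤n
dominated c {x ∷ ν} sorted x≤ = +-mono-≤ x≤ (dominated c (Linked.tail sorted) (tail-below sorted x≤))

dominated-rigid : ∀ c {μ} → Linked _>_ μ → firstPart μ ≤ c + length μ →
                  size μ ≡ size (stair c (length μ)) → μ ≡ stair c (length μ)
dominated-rigid c {[]}    _      _  _  = refl
dominated-rigid c {x ∷ ν} sorted x≤ eq =
  cong₂ _∷_ (proj₁ split) (dominated-rigid c (Linked.tail sorted) below (proj₂ split))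
  where
  below : firstPart ν ≤ c + length ν
  below = tail-below sorted x≤
  split : x ≡ c + suc (length ν) × size ν ≡ size (stair c (length ν))
  split = ≤-+-rigid x≤ (dominated c (Linked.tail sorted) below) eq

length≤first : ∀ {μ} → All (1 ≤_) μ → Linked _>_ μ → length μ ≤ firstPart μ
length≤first {[]}        _         _              = z≤n
length≤first {x ∷ []}    (x≥1 ∷ _) _              = x≥1
length≤first {x ∷ y ∷ μ} (_ ∷ pos) (x>y ∷ sorted) = ≤-trans (s≤s (length≤first pos sorted)) x>y

dominating-stair : ∀ {t μ} → 2 ≤ t → DistinctCore t μ → Σ ℕ λ c →
  c + length μ + length μ ≤ t × size μ ≤ size (stair c (length μ)) ×
  (size μ ≡ size (stair c (length μ)) → μ ≡ stair c (length μ))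
dominating-stair {t} {μ} 2≤t ((pos , _) , distinct , core , core′) =
  c , fits , dominated c distinct first≤ , dominated-rigid c distinct first≤
  where
  c : ℕ
  c = firstPart μ ∸ length μ
  c+ℓ≡first : c + length μ ≡ firstPart μ
  c+ℓ≡first = m∸n+n≡m (length≤first pos distinct)
  first≤ : firstPart μ ≤ c + length μ
  first≤ = ≤-reflexive (sym c+ℓ≡first)
  fits : c + length μ + length μ ≤ t
  fits = subst (λ a → a + length μ ≤ t) (sym c+ℓ≡first) (small-of-core 2≤t pos distinct core core′)

≤-floor : ∀ d .{{_ : NonZero d}} {p n} → d * p ≤ n → p ≤ n / d
≤-floor d {p} {n} dp≤n = begin
  p          ≡⟨ m*n/n≡m p d ⟨
  p * d / d  ≤⟨ /-monoˡ-≤ d (≤-trans (≤-reflexive (*-comm p d)) dp≤n) ⟩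
  n / d      ∎
  where open ≤-Reasoning

floor-exact : ∀ d .{{_ : NonZero d}} {p r n} → n ≡ d * p + r → r < d → n / d ≡ p
floor-exact d {p} {r} refl r<d =
  ≤-antisym (≤-pred (m<n*o⇒m/o<n below)) (≤-floor d (m≤m+n (d * p) r))
  where
  below : d * p + r < suc p * d
  below = begin-strict
    d * p + r   <⟨ +-monoʳ-< (d * p) r<d ⟩
    d * p + d   ≡⟨ solve (d List.∷ p List.∷ List.[]) ⟩
    suc p * d   ∎
    where open ≤-Reasoning

-- How far a shape (c, ℓ) is from c = ℓ: either c = d + ℓ or ℓ = d + c + 1.
data Imbalance : ℕ → ℕ → ℕ → Set where
  wide : ∀ d ℓ → Imbalance (d + ℓ) ℓ d
  tall : ∀ d c → Imbalance c (suc (d + c)) d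

imbalance : ∀ c ℓ → Σ ℕ (Imbalance c ℓ)
imbalance c ℓ with ℓ ≤? c
... | yes ℓ≤c = c ∸ ℓ , subst (λ x → Imbalance x ℓ (c ∸ ℓ)) (m∸n+n≡m ℓ≤c) (wide (c ∸ ℓ) ℓ)
... | no  ℓ≰c = ℓ ∸ suc c ,
  subst (λ y → Imbalance c y (ℓ ∸ suc c)) (trans (sym (+-suc _ c)) (m∸n+n≡m (≰⇒> ℓ≰c))) (tall (ℓ ∸ suc c) c)

-- The amount d(d+1) + e(2s + e + 1) by which t(t+1) exceeds 6 · size for a
-- staircase with s = c + 2ℓ, t = s + e and imbalance d (see stair-defect).
defect : ℕ → ℕ → ℕ → ℕ
defect d s e = d * suc d + e * suc (2 * s + e)

stair-defect : ∀ {c ℓ d t} e → Imbalance c ℓ d → c + ℓ + ℓ + e ≡ t →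
               t * suc t ≡ 6 * size (stair c ℓ) + defect d (c + ℓ + ℓ) e
stair-defect {c} {ℓ} {d} e imb refl = begin
  (c + ℓ + ℓ + e) * suc (c + ℓ + ℓ + e)   ≡⟨ expand imb ⟩
  3 * (2 * c * ℓ + ℓ * suc ℓ) + D         ≡⟨ cong (λ n → 3 * n + D) (double-stair-size c ℓ) ⟨
  3 * (2 * size (stair c ℓ)) + D          ≡⟨ cong (_+ D) (*-assoc 3 2 (size (stair c ℓ))) ⟨
  6 * size (stair c ℓ) + D                ∎
  where
  open ≡-Reasoning
  D : ℕ
  D = defect d (c + ℓ + ℓ) e
  expand : ∀ {a b δ} → Imbalance a b δ →
    (a + b + b + e) * suc (a + b + b + e) ≡
    3 * (2 * a * b + b * suc b) + (δ * suc δ + e * suc (2 * (a + b + b) + e))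
  expand (wide δ b) = solve (δ List.∷ b List.∷ e List.∷ List.[])
  expand (tall δ a) = solve (δ List.∷ a List.∷ e List.∷ List.[])

stair-bound : ∀ {c ℓ t} → c + ℓ + ℓ ≤ t → size (stair c ℓ) ≤ t * suc t / 6
stair-bound {c} {ℓ} {t} fits =
  ≤-floor 6 (subst (6 * size (stair c ℓ) ≤_) (sym (stair-defect _ imb (m+[n∸m]≡n fits))) (m≤m+n _ _))
  where
  imb : Imbalance c ℓ (proj₁ (imbalance c ℓ))
  imb = proj₂ (imbalance c ℓ)

small-defect : ∀ {d s} e → 2 ≤ s + e → defect d s e ≤ 2 → e ≡ 0 × d ≤ 1
small-defect {zero}        zero _ _ = refl , z≤n
small-defect {suc zero}    zero _ _ = refl , ≤-refl
small-defect {suc (suc d)} zero _ (s≤s (s≤s ()))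
small-defect {d} {s} (suc e) 2≤s+e defect≤2 = contradiction defect≤2 (<⇒≱ 2<ex)
  where
  open ≤-Reasoning
  2<ex : 2 < defect d s (suc e)
  2<ex = begin-strict
    2                             ≤⟨ 2≤s+e ⟩
    s + suc e                     ≤⟨ +-monoˡ-≤ (suc e) (m≤m+n s (s + 0)) ⟩
    2 * s + suc e                 <⟨ n<1+n _ ⟩
    suc (2 * s + suc e)           ≤⟨ m≤n*m _ (suc e) ⟩
    suc e * suc (2 * s + suc e)   ≤⟨ m≤n+m _ (d * suc d) ⟩
    defect d s (suc e)            ∎

-- The balanced shapes c − ℓ ∈ {0, 1, −1, −2}; Balanced r q c ℓ also records the
-- decomposition c + 2ℓ = r + 3q with r < 3.
data Balanced : ℕ → ℕ → ℕ → ℕ → Set where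
  Δ0  : ∀ q → Balanced 0 q q q
  Δ+1 : ∀ q → Balanced 1 q (suc q) q
  Δ-1 : ∀ q → Balanced 2 q q (suc q)
  Δ-2 : ∀ q → Balanced 1 (suc q) q (suc (suc q))

balanced-sum : ∀ {r q c ℓ} → Balanced r q c ℓ → c + ℓ + ℓ ≡ r + q * 3
balanced-sum (Δ0 q)  = solve (q List.∷ List.[])
balanced-sum (Δ+1 q) = solve (q List.∷ List.[])
balanced-sum (Δ-1 q) = solve (q List.∷ List.[])
balanced-sum (Δ-2 q) = solve (q List.∷ List.[])

balanced-residue : ∀ {r q c ℓ} → Balanced r q c ℓ → r < 3
balanced-residue (Δ0 _)  = s≤s z≤n
balanced-residue (Δ+1 _) = s≤s (s≤s z≤n)
balanced-residue (Δ-1 _) = s≤s (s≤s (s≤s z≤n))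
balanced-residue (Δ-2 _) = s≤s (s≤s z≤n)

balanced-imbalance : ∀ {r q c ℓ} → Balanced r q c ℓ → Σ ℕ λ d → d ≤ 1 × Imbalance c ℓ d
balanced-imbalance (Δ0 q)  = 0 , z≤n , wide 0 q
balanced-imbalance (Δ+1 q) = 1 , ≤-refl , wide 1 q
balanced-imbalance (Δ-1 q) = 0 , z≤n , tall 0 q
balanced-imbalance (Δ-2 q) = 1 , ≤-refl , tall 1 q

imbalance-balanced : ∀ {c ℓ d} → Imbalance c ℓ d → d ≤ 1 → Σ ℕ λ r → Σ ℕ λ q → Balanced r q c ℓ
imbalance-balanced (wide 0 ℓ) _ = 0 , ℓ , Δ0 ℓ
imbalance-balanced (wide 1 ℓ) _ = 1 , ℓ , Δ+1 ℓ
imbalance-balanced (tall 0 c) _ = 2 , c , Δ-1 c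
imbalance-balanced (tall 1 c) _ = 1 , suc c , Δ-2 c
imbalance-balanced (wide (suc (suc _)) _) (s≤s ())
imbalance-balanced (tall (suc (suc _)) _) (s≤s ())

thirds-unique : ∀ {r q r′ q′} → r < 3 → r′ < 3 → r + q * 3 ≡ r′ + q′ * 3 → r ≡ r′ × q ≡ q′
thirds-unique {r} {q} {r′} {q′} r<3 r′<3 eq =
  r≡r′ , *-cancelʳ-≡ q q′ 3 (+-cancelˡ-≡ r _ _ (trans eq (cong (_+ q′ * 3) (sym r≡r′))))
  where
  open ≡-Reasoning
  r≡r′ : r ≡ r′
  r≡r′ = begin
    r                  ≡⟨ m<n⇒m%n≡m r<3 ⟨
    r % 3              ≡⟨ [m+kn]%n≡m%n r q 3 ⟨
    (r + q * 3) % 3    ≡⟨ cong (_% 3) eq ⟩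
    (r′ + q′ * 3) % 3  ≡⟨ [m+kn]%n≡m%n r′ q′ 3 ⟩
    r′ % 3             ≡⟨ m<n⇒m%n≡m r′<3 ⟩
    r′                 ∎

reindex : ∀ {r q c ℓ r′ q′} → Balanced r q c ℓ → r′ < 3 → c + ℓ + ℓ ≡ r′ + q′ * 3 → Balanced r′ q′ c ℓ
reindex {r} {q} {r′ = r′} {q′} b r′<3 eq
  with thirds-unique {r} {q} {r′} {q′} (balanced-residue b) r′<3 (trans (sym (balanced-sum b)) eq)
... | refl , refl = b

some-balanced : ∀ r q → r < 3 → Σ ℕ λ c → Σ ℕ λ ℓ → Balanced r q c ℓ
some-balanced 0 q _ = q , q , Δ0 q
some-balanced 1 q _ = suc q , q , Δ+1 q
some-balanced 2 q _ = q , suc q , Δ-1 q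
some-balanced (suc (suc (suc _))) q (s≤s (s≤s (s≤s ())))

balanced-defect : ∀ {r q c ℓ} → Balanced r q c ℓ → Σ ℕ λ g →
                  g ≤ 2 × (c + ℓ + ℓ) * suc (c + ℓ + ℓ) ≡ 6 * size (stair c ℓ) + g
balanced-defect {c = c} {ℓ} b with balanced-imbalance b
... | d , d≤1 , imb =
  defect d (c + ℓ + ℓ) 0 , +-mono-≤ (*-mono-≤ d≤1 (s≤s d≤1)) z≤n , stair-defect 0 imb (+-identityʳ _)

balanced-size : ∀ {r q c ℓ} → Balanced r q c ℓ → size (stair c ℓ) ≡ (c + ℓ + ℓ) * suc (c + ℓ + ℓ) / 6
balanced-size b with balanced-defect b
... | g , g≤2 , eq = sym (floor-exact 6 eq (s≤s (≤-trans g≤2 (s≤s (s≤s z≤n)))))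

-- t(t+1) exceeds 6⌊t(t+1)/6⌋ by at most 2, as a balanced staircase of sum t shows.
oblong-remainder : ∀ t → Σ ℕ λ g → g ≤ 2 × t * suc t ≡ 6 * (t * suc t / 6) + g
oblong-remainder t with some-balanced (t % 3) (t / 3) (m%n<n t 3)
... | c , ℓ , b with balanced-defect b
...   | g , g≤2 , eq = g , g≤2 , subst (λ s → s * suc s ≡ 6 * (s * suc s / 6) + g) s≡t
                                       (trans eq (cong (λ n → 6 * n + g) (balanced-size b)))
  where
  s≡t : c + ℓ + ℓ ≡ t
  s≡t = trans (balanced-sum b) (sym (m≡m%n+[m/n]*n t 3))

tight-defect : ∀ {c ℓ d t} e → Imbalance c ℓ d → c + ℓ + ℓ + e ≡ t →
               size (stair c ℓ) ≡ t * suc t / 6 → defect d (c + ℓ + ℓ) e ≤ 2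
tight-defect {c} {ℓ} {d} {t} e imb s+e≡t tight with oblong-remainder t
... | g , g≤2 , t≡ = ≤-trans (≤-reflexive defect≡g) g≤2
  where
  open ≡-Reasoning
  defect≡g : defect d (c + ℓ + ℓ) e ≡ g
  defect≡g = +-cancelˡ-≡ (6 * size (stair c ℓ)) _ _ (begin
    6 * size (stair c ℓ) + defect d (c + ℓ + ℓ) e   ≡⟨ stair-defect e imb s+e≡t ⟨
    t * suc t                                       ≡⟨ t≡ ⟩
    6 * (t * suc t / 6) + g                         ≡⟨ cong (λ n → 6 * n + g) tight ⟨
    6 * size (stair c ℓ) + g                        ∎)

tight-stair : ∀ {c ℓ d t} → Imbalance c ℓ d → 2 ≤ t → c + ℓ + ℓ ≤ t →
              size (stair c ℓ) ≡ t * suc t / 6 → c + ℓ + ℓ ≡ t × d ≤ 1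
tight-stair {c} {ℓ} {d} {t} imb 2≤t fits tight =
  trans (sym (+-identityʳ _)) (subst (λ e → c + ℓ + ℓ + e ≡ t) (proj₁ shape) s+e≡t) , proj₂ shape
  where
  s+e≡t : c + ℓ + ℓ + (t ∸ (c + ℓ + ℓ)) ≡ t
  s+e≡t = m+[n∸m]≡n fits
  shape : t ∸ (c + ℓ + ℓ) ≡ 0 × d ≤ 1
  shape = small-defect _ (subst (2 ≤_) (sym s+e≡t) 2≤t) (tight-defect _ imb s+e≡t tight)

size-bound : ∀ {t μ} → 2 ≤ t → DistinctCore t μ → size μ ≤ t * suc t / 6
size-bound {μ = μ} 2≤t core with dominating-stair 2≤t core
... | c , fits , below , _ = ≤-trans below (stair-bound {c} {length μ} fits)

BalancedStair : ℕ → ℕ → List ℕ → Set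
BalancedStair r q μ = Σ ℕ λ c → Σ ℕ λ ℓ → Balanced r q c ℓ × μ ≡ stair c ℓ

maximizer⇒balanced : ∀ {t μ} → 2 ≤ t → DistinctCore t μ → size μ ≡ t * suc t / 6 →
                     BalancedStair (t % 3) (t / 3) μ
maximizer⇒balanced {t} {μ} 2≤t core max with dominating-stair 2≤t core
... | c , fits , below , rigid =
  let (d , imb)   = imbalance c (length μ)
      (s≡t , d≤1) = tight-stair imb 2≤t fits stair-max
      (_ , _ , b) = imbalance-balanced imb d≤1
  in c , length μ , reindex b (m%n<n t 3) (trans s≡t (m≡m%n+[m/n]*n t 3)) , rigid (trans max (sym stair-max))
  where
  stair-max : size (stair c (length μ)) ≡ t * suc t / 6
  stair-max = ≤-antisym (stair-bound {c} {length μ} fits) (subst (_≤ size (stair c (length μ))) max below)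

balanced⇒maximizer : ∀ {t μ} → BalancedStair (t % 3) (t / 3) μ → DistinctCore t μ × size μ ≡ t * suc t / 6
balanced⇒maximizer {t} (c , ℓ , b , refl) =
  distinct-core-of-small (stair-partition c ℓ) (stair-distinct c ℓ) small ,
  trans (balanced-size b) (cong (λ s → s * suc s / 6) s≡t)
  where
  s≡t : c + ℓ + ℓ ≡ t
  s≡t = trans (balanced-sum b) (sym (m≡m%n+[m/n]*n t 3))
  small : firstPart (stair c ℓ) + length (stair c ℓ) ≤ t
  small = ≤-trans (+-mono-≤ (stair-first c ℓ) (≤-reflexive (stair-length c ℓ))) (≤-reflexive s≡t)

balanced⇔maximizer : ∀ {t μ} → 2 ≤ t → BalancedStair (t % 3) (t / 3) μ ⇔ (DistinctCore t μ × size μ ≡ t * suc t / 6)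
balanced⇔maximizer 2≤t = mk⇔ balanced⇒maximizer (λ (core , max) → maximizer⇒balanced 2≤t core max)

-- The balanced staircases for residue r and quotient q with r + 3q ≥ 2: a single
-- one unless r = 1, where c − ℓ = 1 and c − ℓ = −2 both occur (with different lengths).
balanced-stairs : ∀ r q → r < 3 → 2 ≤ r + q * 3 → Σ (List (List ℕ)) λ L →
  Unique L × (∀ μ → μ ∈ L ⇔ BalancedStair r q μ) × length L ≡ (if r ≡ᵇ 1 then 2 else 1)
balanced-stairs 0 q _ _ =
  stair q q ∷ [] , [] ∷ [] ,
  (λ μ → mk⇔ (λ { (here refl) → q , q , Δ0 q , refl }) (λ { (_ , _ , Δ0 _ , refl) → here refl })) ,
  refl
balanced-stairs 1 zero _ (s≤s ())
balanced-stairs 1 (suc p) _ _ =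
  stair (suc (suc p)) (suc p) ∷ stair p (suc (suc p)) ∷ [] ,
  ((λ eq → 1+n≢n (sym (stair-length-injective eq))) ∷ []) ∷ [] ∷ [] ,
  (λ μ → mk⇔ (λ { (here refl)         → suc (suc p) , suc p , Δ+1 (suc p) , refl
                ; (there (here refl)) → p , suc (suc p) , Δ-2 p , refl })
              (λ { (_ , _ , Δ+1 _ , refl) → here refl
                 ; (_ , _ , Δ-2 _ , refl) → there (here refl) })) ,
  refl
balanced-stairs 2 q _ _ =
  stair q (suc q) ∷ [] , [] ∷ [] ,
  (λ μ → mk⇔ (λ { (here refl) → q , suc q , Δ-1 q , refl }) (λ { (_ , _ , Δ-1 _ , refl) → here refl })) ,
  refl
balanced-stairs (suc (suc (suc _))) q (s≤s (s≤s (s≤s ()))) _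

corollary1p3 : (t : ℕ) → 2 ≤ t →
    (∀ (μ : List ℕ) → DistinctCore t μ → size μ ≤ (t * suc t) / 6) ×
    Σ (List (List ℕ)) (λ L →
    Unique L ×
    (∀ (μ : List ℕ) → (μ ∈ L) ⇔ (DistinctCore t μ × size μ ≡ (t * suc t) / 6)) ×
    length L ≡ (if (t % 3) ≡ᵇ 1 then 2 else 1))
corollary1p3 t 2≤t =
  let (L , unique , L⇔balanced , count) =
        balanced-stairs (t % 3) (t / 3) (m%n<n t 3) (subst (2 ≤_) (m≡m%n+[m/n]*n t 3) 2≤t)
  in (λ μ → size-bound 2≤t) , L , unique , (λ μ → ⇔-trans (L⇔balanced μ) (balanced⇔maximizer 2≤t)) , count
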